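{- For every positive integer $k$, \[ B_{2k}=\frac{k}{(2^{2k}-1)2^{2k-1}}\Biggl[1-\sum_{\ell=1}^{k-1} \binom{2k-1}{2\ell-1} \bigl(2^{2\ell}-1\bigr)2^{2\ell} \frac{B_{2\ell}}{2\ell}\Biggr]. \]
   Context: The Bernoulli numbers $B_n$ are defined by $\frac{z}{e^z-1}=\sum_{n=0}^\infty B_n\frac{z^n}{n!}$ for $|z|<2\pi$. An empty sum is $0$. -}

module Defs where

open import Data.Nat as ℕ using (ℕ; zero; suc; _∸_; _^_)
open import Data.Nat.Combinatorics using (_C_)
open import Data.Integer using (+_)
open import Data.Rational using (ℚ; 0ℚ; 1ℚ; _+_; _*_; -_; _/_)
open import Data.Fin using (Fin; toℕ)
open import Data.Vec using (Vec; []; _∷ʳ_; lookup)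
open import Data.List using (List; map; foldr; upTo)

ℕ→ℚ : ℕ → ℚ
ℕ→ℚ n = + n / 1

-- n / d as a rational, for d ≠ 0 (only ever used with nonzero d;
-- the value 0 for d = 0 is an arbitrary junk value)
frac : ℕ → ℕ → ℚ
frac n zero    = 0ℚ
frac n (suc d) = + n / suc d

sumℚ : List ℚ → ℚ
sumℚ = foldr _+_ 0ℚ

Σ< : ℕ → (ℕ → ℚ) → ℚ
Σ< n f = sumℚ (map f (upTo n))

-- Given the table B_0 … B_{n-1}, compute B_n from the recurrence
--   B_0 = 1,   Σ_{j=0}^{n} C(n+1, j) B_j = 0   (n ≥ 1),
-- which is equivalent to z/(e^z - 1) = Σ B_n z^n / n!.
nextB : (n : ℕ) → Vec ℚ n → ℚ
nextB zero    _  = 1ℚ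
nextB (suc n) bs =
  - (frac 1 (suc (suc n)) *
     sumℚ (map (λ (j : Fin (suc n)) → ℕ→ℚ (suc (suc n) C toℕ j) * lookup bs j)
               (Data.List.allFin (suc n))))
  where import Data.List

bernoulliTable : (n : ℕ) → Vec ℚ n
bernoulliTable zero    = []
bernoulliTable (suc n) = bernoulliTable n ∷ʳ nextB n (bernoulliTable n)

-- the Bernoulli number B_n  (convention B_1 = -1/2)
B : ℕ → ℚ
B n = nextB n (bernoulliTable n)

-- Read sequences as exponential generating functions.  The recurrence defining B says
-- e^z B(z) = B(z) + z, i.e. B(z) = z/(e^z − 1).  Hence H(z) := B(4z) − B(2z) satisfies
-- (e^{2z} + 1) H(z) = −2z: the difference of the two sides is killed by e^{2z} − 1, and
-- multiplication by e^{cz} (c ≠ 0) fixes no nonzero series.  So H(z) = z tanh z − z, and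
-- e^z H(z) = −z / cosh z is odd while H(z) + z is even.  The coefficient of z^{2k}/(2k)! in
-- e^z H(z) is therefore 0 = Σ_j C(2k, j) h_j with h_j = (4^j − 2^j) B_j, where h_1 = −1 and
-- h_j = 0 for the other odd j.  Using C(2k, 2ℓ) = (2k / 2ℓ) C(2k − 1, 2ℓ − 1) this says that
-- the sum in the theorem, extended to ℓ = k, equals 1; solving for the term ℓ = k gives B_{2k}.

module Submission where

open import Defs
open import Data.Nat using (ℕ; _≤_; _∸_; _^_; suc) renaming (_*_ to _*ℕ_)
open import Data.Nat.Combinatorics using (_C_)
open import Data.Rational using (ℚ; 1ℚ; _*_; _-_)
open import Relation.Binary.PropositionalEquality using (_≡_)

open import Data.Nat using (zero; _<_)
import Data.Nat as ℕ
import Data.Nat.Properties as ℕ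
open import Data.Nat.Combinatorics
  using (nCn≡1; nC1≡n; nCk≡nC[n∸k]; k>n⇒nCk≡0; nCk+nC[k+1]≡[n+1]C[k+1])
open import Data.Nat.Induction using (<-rec)
import Data.Integer as ℤ
import Data.Integer.Properties as ℤ
open import Data.Fin using (Fin; toℕ)
import Data.Fin.Properties as Fin
open import Data.List using (map; applyUpTo; tabulate; allFin)
import Data.List.Properties as List
open import Data.Vec using (Vec; []; _∷_; _∷ʳ_; lookup)
open import Data.Rational using (0ℚ; _+_; -_; 1/_; NonZero; fromℚᵘ)
import Data.Rational.Properties as ℚ
open import Data.Rational.Unnormalised using (mkℚᵘ; *≡*) renaming (_+_ to _+ᵘ_; _*_ to _*ᵘ_)
import Data.Rational.Unnormalised.Properties as ℚᵘ
open import Algebra.Bundles using (CommutativeRing)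
open CommutativeRing ℚ.+-*-commutativeRing using (semiring; commutativeSemiring)
open import Algebra.Properties.Semiring.Sum semiring
  using (sum; sum-cong-≗; sum-init-last; ∑-distrib-+; *-distribˡ-sum)
open import Algebra.Properties.CommutativeSemiring.Exp commutativeSemiring
  using (^-distrib-*) renaming (_^_ to _^ℚ_)
open import Function using (_∘_)
open import Relation.Binary.PropositionalEquality
  using (refl; sym; trans; cong; cong₂; _≗_; module ≡-Reasoning)
open ≡-Reasoning

[1+n]Cn≡1+n : ∀ n → suc n C n ≡ suc n
[1+n]Cn≡1+n n = begin
  suc n C n           ≡⟨ nCk≡nC[n∸k] (ℕ.n≤1+n n) ⟩
  suc n C (suc n ∸ n) ≡⟨ cong (suc n C_) (ℕ.m+n∸n≡m 1 n) ⟩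
  suc n C 1           ≡⟨ nC1≡n (suc n) ⟩
  suc n               ∎

[1+k]*[1+n]C[1+k]≡[1+n]*nCk : ∀ n k → suc k *ℕ (suc n C suc k) ≡ suc n *ℕ (n C k)
[1+k]*[1+n]C[1+k]≡[1+n]*nCk zero    zero    = refl
[1+k]*[1+n]C[1+k]≡[1+n]*nCk zero    (suc k) = ℕ.*-zeroʳ (suc (suc k))
[1+k]*[1+n]C[1+k]≡[1+n]*nCk (suc n) zero    =
  trans (ℕ.*-identityˡ _) (trans (nC1≡n (suc (suc n))) (sym (ℕ.*-identityʳ (suc (suc n)))))
[1+k]*[1+n]C[1+k]≡[1+n]*nCk (suc n) (suc k) = begin
  suc (suc k) *ℕ (suc (suc n) C suc (suc k))
    ≡⟨ cong (suc (suc k) *ℕ_) (nCk+nC[k+1]≡[n+1]C[k+1] (suc n) (suc k)) ⟨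
  suc (suc k) *ℕ (x ℕ.+ y)
    ≡⟨ solve 3 (λ k x y → (con 2 :+ k) :* (x :+ y) := (con 1 :+ k) :* x :+ x :+ (con 2 :+ k) :* y)
               refl k x y ⟩
  suc k *ℕ x ℕ.+ x ℕ.+ suc (suc k) *ℕ y
    ≡⟨ cong₂ (λ a b → a ℕ.+ x ℕ.+ b) ([1+k]*[1+n]C[1+k]≡[1+n]*nCk n k)
                                      ([1+k]*[1+n]C[1+k]≡[1+n]*nCk n (suc k)) ⟩
  suc n *ℕ (n C k) ℕ.+ x ℕ.+ suc n *ℕ (n C suc k)
    ≡⟨ solve 4 (λ n u v x → (con 1 :+ n) :* u :+ x :+ (con 1 :+ n) :* v := (con 1 :+ n) :* (u :+ v) :+ x)
               refl n (n C k) (n C suc k) x ⟩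
  suc n *ℕ (n C k ℕ.+ n C suc k) ℕ.+ x
    ≡⟨ cong (λ a → suc n *ℕ a ℕ.+ x) (nCk+nC[k+1]≡[n+1]C[k+1] n k) ⟩
  suc n *ℕ x ℕ.+ x
    ≡⟨ solve 2 (λ n x → (con 1 :+ n) :* x :+ x := (con 2 :+ n) :* x) refl n x ⟩
  suc (suc n) *ℕ x ∎
  where
  open import Data.Nat.Solver using (module +-*-Solver)
  open +-*-Solver
  x y : ℕ
  x = suc n C suc k
  y = suc n C suc (suc k)

open import Data.Rational.Solver using (module +-*-Solver)
open +-*-Solver

fromℚᵘ-homo-+ : ∀ p q → fromℚᵘ (p +ᵘ q) ≡ fromℚᵘ p + fromℚᵘ q
fromℚᵘ-homo-+ p q = ℚ.toℚᵘ-injective (ℚᵘ.≃-trans (ℚ.toℚᵘ-fromℚᵘ (p +ᵘ q))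
  (ℚᵘ.≃-sym (ℚᵘ.≃-trans (ℚ.toℚᵘ-homo-+ (fromℚᵘ p) (fromℚᵘ q))
                        (ℚᵘ.+-cong (ℚ.toℚᵘ-fromℚᵘ p) (ℚ.toℚᵘ-fromℚᵘ q)))))

fromℚᵘ-homo-* : ∀ p q → fromℚᵘ (p *ᵘ q) ≡ fromℚᵘ p * fromℚᵘ q
fromℚᵘ-homo-* p q = ℚ.toℚᵘ-injective (ℚᵘ.≃-trans (ℚ.toℚᵘ-fromℚᵘ (p *ᵘ q))
  (ℚᵘ.≃-sym (ℚᵘ.≃-trans (ℚ.toℚᵘ-homo-* (fromℚᵘ p) (fromℚᵘ q))
                        (ℚᵘ.*-cong (ℚ.toℚᵘ-fromℚᵘ p) (ℚ.toℚᵘ-fromℚᵘ q)))))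

frac-cong : ∀ {a b c d} → a *ℕ suc d ≡ c *ℕ suc b → frac a (suc b) ≡ frac c (suc d)
frac-cong {a} {b} {c} {d} ad≡cb = ℚ.fromℚᵘ-cong {mkℚᵘ (ℤ.+ a) b} {mkℚᵘ (ℤ.+ c) d} (*≡* (begin
  ℤ.+ a ℤ.* ℤ.+ suc d ≡⟨ ℤ.pos-* a (suc d) ⟨
  ℤ.+ (a *ℕ suc d)    ≡⟨ cong ℤ.+_ ad≡cb ⟩
  ℤ.+ (c *ℕ suc b)    ≡⟨ ℤ.pos-* c (suc b) ⟩
  ℤ.+ c ℤ.* ℤ.+ suc b ∎))

frac-* : ∀ a b c d → frac a (suc b) * frac c (suc d) ≡ frac (a *ℕ c) (suc b *ℕ suc d)
frac-* a b c d = trans (sym (fromℚᵘ-homo-* (mkℚᵘ (ℤ.+ a) b) (mkℚᵘ (ℤ.+ c) d)))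
  (ℚ.fromℚᵘ-cong {mkℚᵘ (ℤ.+ a) b *ᵘ mkℚᵘ (ℤ.+ c) d} {mkℚᵘ (ℤ.+ (a *ℕ c)) (d ℕ.+ b *ℕ suc d)}
                 (*≡* (cong (ℤ._* ℤ.+ (suc b *ℕ suc d)) (sym (ℤ.pos-* a c)))))

frac-*-ℕ→ℚ : ∀ a b .{{_ : ℕ.NonZero b}} → frac a b * ℕ→ℚ b ≡ ℕ→ℚ a
frac-*-ℕ→ℚ a (suc b) =
  trans (frac-* a b (suc b) 0) (frac-cong {a *ℕ suc b} {b *ℕ 1} {a} {0} (ℕ.*-assoc a (suc b) 1))

ℕ→ℚ-* : ∀ m n → ℕ→ℚ (m *ℕ n) ≡ ℕ→ℚ m * ℕ→ℚ n
ℕ→ℚ-* m n = sym (frac-* m 0 n 0)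

ℕ→ℚ-+ : ∀ m n → ℕ→ℚ (m ℕ.+ n) ≡ ℕ→ℚ m + ℕ→ℚ n
ℕ→ℚ-+ m n =
  trans (ℚ.fromℚᵘ-cong {mkℚᵘ (ℤ.+ (m ℕ.+ n)) 0} {mkℚᵘ (ℤ.+ m) 0 +ᵘ mkℚᵘ (ℤ.+ n) 0} (*≡* numerators))
        (fromℚᵘ-homo-+ (mkℚᵘ (ℤ.+ m) 0) (mkℚᵘ (ℤ.+ n) 0))
  where
  numerators : ℤ.+ (m ℕ.+ n) ℤ.* ℤ.+ 1 ≡ (ℤ.+ m ℤ.* ℤ.+ 1 ℤ.+ ℤ.+ n ℤ.* ℤ.+ 1) ℤ.* ℤ.+ 1
  numerators = cong (ℤ._* ℤ.+ 1) (trans (ℤ.pos-+ m n)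
                 (sym (cong₂ ℤ._+_ (ℤ.*-identityʳ (ℤ.+ m)) (ℤ.*-identityʳ (ℤ.+ n)))))

ℕ→ℚ-∸ : ∀ {m n} → n ≤ m → ℕ→ℚ (m ∸ n) ≡ ℕ→ℚ m - ℕ→ℚ n
ℕ→ℚ-∸ {m} {n} n≤m = begin
  ℕ→ℚ (m ∸ n)                  ≡⟨ solve 2 (λ x y → x := x :+ y :- y) refl (ℕ→ℚ (m ∸ n)) (ℕ→ℚ n) ⟩
  ℕ→ℚ (m ∸ n) + ℕ→ℚ n - ℕ→ℚ n ≡⟨ cong (_- ℕ→ℚ n) (ℕ→ℚ-+ (m ∸ n) n) ⟨
  ℕ→ℚ (m ∸ n ℕ.+ n) - ℕ→ℚ n   ≡⟨ cong (λ k → ℕ→ℚ k - ℕ→ℚ n) (ℕ.m∸n+n≡m n≤m) ⟩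
  ℕ→ℚ m - ℕ→ℚ n                ∎

ℕ→ℚ-^ : ∀ m n → ℕ→ℚ (m ^ n) ≡ ℕ→ℚ m ^ℚ n
ℕ→ℚ-^ m zero    = refl
ℕ→ℚ-^ m (suc n) = trans (ℕ→ℚ-* m (m ^ n)) (cong (ℕ→ℚ m *_) (ℕ→ℚ-^ m n))

ℕ→ℚ-[1+n]C[1+k] : ∀ n k → ℕ→ℚ (suc n C suc k) ≡ ℕ→ℚ (suc n) * ℕ→ℚ (n C k) * frac 1 (suc k)
ℕ→ℚ-[1+n]C[1+k] n k = begin
  C′                                 ≡⟨ ℚ.*-identityˡ C′ ⟨
  1ℚ * C′                            ≡⟨ cong (_* C′) (frac-*-ℕ→ℚ 1 (suc k)) ⟨
  F * ℕ→ℚ (suc k) * C′               ≡⟨ ℚ.*-assoc F (ℕ→ℚ (suc k)) C′ ⟩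
  F * (ℕ→ℚ (suc k) * C′)             ≡⟨ cong (F *_) (ℕ→ℚ-* (suc k) (suc n C suc k)) ⟨
  F * ℕ→ℚ (suc k *ℕ (suc n C suc k)) ≡⟨ cong (λ c → F * ℕ→ℚ c) ([1+k]*[1+n]C[1+k]≡[1+n]*nCk n k) ⟩
  F * ℕ→ℚ (suc n *ℕ (n C k))         ≡⟨ cong (F *_) (ℕ→ℚ-* (suc n) (n C k)) ⟩
  F * (ℕ→ℚ (suc n) * ℕ→ℚ (n C k))    ≡⟨ ℚ.*-comm F _ ⟩
  ℕ→ℚ (suc n) * ℕ→ℚ (n C k) * F      ∎
  where
  C′ F : ℚ
  C′ = ℕ→ℚ (suc n C suc k)
  F  = frac 1 (suc k)

ℕ→ℚ-nonZero : ∀ n → NonZero (ℕ→ℚ (suc n))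
ℕ→ℚ-nonZero n = ℚ.pos⇒nonZero (ℕ→ℚ (suc n)) {{ℚ.normalize-pos (suc n) 1}}

x*y≡0⇒y≡0 : ∀ x {y} .{{_ : NonZero x}} → x * y ≡ 0ℚ → y ≡ 0ℚ
x*y≡0⇒y≡0 x {y} xy≡0 = begin
  y              ≡⟨ ℚ.*-identityˡ y ⟨
  1ℚ * y         ≡⟨ cong (_* y) (ℚ.*-inverseˡ x) ⟨
  1/ x * x * y   ≡⟨ ℚ.*-assoc (1/ x) x y ⟩
  1/ x * (x * y) ≡⟨ cong (1/ x *_) xy≡0 ⟩
  1/ x * 0ℚ      ≡⟨ ℚ.*-zeroʳ (1/ x) ⟩
  0ℚ             ∎

-1ℚ 2ℚ 4ℚ : ℚ
-1ℚ = - 1ℚ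
2ℚ  = ℕ→ℚ 2
4ℚ  = ℕ→ℚ 4

[-1]^[2m]≡1 : ∀ m → -1ℚ ^ℚ (2 *ℕ m) ≡ 1ℚ
[-1]^[2m]≡1 zero    = refl
[-1]^[2m]≡1 (suc m) = begin
  -1ℚ ^ℚ (2 *ℕ suc m)            ≡⟨ cong (-1ℚ ^ℚ_) (ℕ.*-suc 2 m) ⟩
  -1ℚ * (-1ℚ * -1ℚ ^ℚ (2 *ℕ m)) ≡⟨ cong (λ p → -1ℚ * (-1ℚ * p)) ([-1]^[2m]≡1 m) ⟩
  -1ℚ * (-1ℚ * 1ℚ)              ≡⟨⟩
  1ℚ                             ∎

ℕ→ℚ-[2^L-1]*2^L : ∀ L → ℕ→ℚ ((2 ^ L ∸ 1) *ℕ 2 ^ L) ≡ 4ℚ ^ℚ L - 2ℚ ^ℚ L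
ℕ→ℚ-[2^L-1]*2^L L = begin
  ℕ→ℚ ((2 ^ L ∸ 1) *ℕ 2 ^ L)       ≡⟨ ℕ→ℚ-* (2 ^ L ∸ 1) (2 ^ L) ⟩
  ℕ→ℚ (2 ^ L ∸ 1) * ℕ→ℚ (2 ^ L)    ≡⟨ cong (_* ℕ→ℚ (2 ^ L)) (ℕ→ℚ-∸ (ℕ.m^n>0 2 L)) ⟩
  (ℕ→ℚ (2 ^ L) - 1ℚ) * ℕ→ℚ (2 ^ L) ≡⟨ cong (λ p → (p - 1ℚ) * p) (ℕ→ℚ-^ 2 L) ⟩
  (2ℚ ^ℚ L - 1ℚ) * 2ℚ ^ℚ L         ≡⟨ solve 1 (λ p → (p :- con 1ℚ) :* p := p :* p :- p) refl (2ℚ ^ℚ L) ⟩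
  2ℚ ^ℚ L * 2ℚ ^ℚ L - 2ℚ ^ℚ L      ≡⟨ cong (_- 2ℚ ^ℚ L) (^-distrib-* 2ℚ 2ℚ L) ⟨
  4ℚ ^ℚ L - 2ℚ ^ℚ L                ∎

Seq : Set
Seq = ℕ → ℚ

∑ : ℕ → Seq → ℚ
∑ n f = sum {n} (f ∘ toℕ)

∑-cong : ∀ n {f g : Seq} → f ≗ g → ∑ n f ≡ ∑ n g
∑-cong n f≗g = sum-cong-≗ {n} (f≗g ∘ toℕ)

∑-last : ∀ n f → ∑ (suc n) f ≡ ∑ n f + f n
∑-last n f = trans (sum-init-last {n} (f ∘ toℕ))
  (cong₂ _+_ (sum-cong-≗ {n} (cong f ∘ Fin.toℕ-inject₁)) (cong f (Fin.toℕ-fromℕ n)))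

∑-pairs : ∀ m f → ∑ (2 *ℕ m) f ≡ ∑ m (λ l → f (2 *ℕ l) + f (suc (2 *ℕ l)))
∑-pairs zero    f = refl
∑-pairs (suc m) f = begin
  ∑ (2 *ℕ suc m) f
    ≡⟨ cong (λ n → ∑ n f) (ℕ.*-suc 2 m) ⟩
  f 0 + (f 1 + ∑ (2 *ℕ m) (f ∘ suc ∘ suc))
    ≡⟨ ℚ.+-assoc (f 0) (f 1) _ ⟨
  f 0 + f 1 + ∑ (2 *ℕ m) (f ∘ suc ∘ suc)
    ≡⟨ cong (f 0 + f 1 +_) (∑-pairs m (f ∘ suc ∘ suc)) ⟩
  f 0 + f 1 + ∑ m (λ l → f (2 ℕ.+ 2 *ℕ l) + f (3 ℕ.+ 2 *ℕ l))
    ≡⟨ cong (f 0 + f 1 +_) (∑-cong m (λ l → cong (λ k → f k + f (suc k)) (ℕ.*-suc 2 l))) ⟨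
  ∑ (suc m) (λ l → f (2 *ℕ l) + f (suc (2 *ℕ l))) ∎

sumℚ-applyUpTo : ∀ n (f : Seq) g → sumℚ (map f (applyUpTo g n)) ≡ ∑ n (f ∘ g)
sumℚ-applyUpTo zero    f g = refl
sumℚ-applyUpTo (suc n) f g = cong (f (g 0) +_) (sumℚ-applyUpTo n f (g ∘ suc))

Σ<≡∑ : ∀ n f → Σ< n f ≡ ∑ n f
Σ<≡∑ n f = sumℚ-applyUpTo n f (λ j → j)

sumℚ-allFin : ∀ n (f : Fin n → ℚ) → sumℚ (map f (allFin n)) ≡ sum f
sumℚ-allFin n f = trans (cong sumℚ (List.map-tabulate (λ i → i) f)) (sumℚ-tabulate f)
  where
  sumℚ-tabulate : ∀ {n} (f : Fin n → ℚ) → sumℚ (tabulate f) ≡ sum f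
  sumℚ-tabulate {zero}  f = refl
  sumℚ-tabulate {suc n} f = cong (f Fin.zero +_) (sumℚ-tabulate (f ∘ Fin.suc))

infixl 6 _⊕_ _⊖_
infixr 7 _⊛_

_⊕_ _⊖_ : Seq → Seq → Seq
(a ⊕ b) n = a n + b n
(a ⊖ b) n = a n - b n

_⊛_ : ℚ → Seq → Seq
(x ⊛ a) n = x * a n

-- A sequence a stands for its exponential generating function A(z) = Σ a n zⁿ/n!.
-- expMul c a is e^{cz} A(z): the recursion is the product rule
-- (e^{cz} A)′ = c e^{cz} A + e^{cz} A′, the derivative A′ being a ∘ suc.
-- dilate c a is A(cz), and δ₁ is z.
expMul : ℚ → Seq → Seq
expMul c a zero    = a zero
expMul c a (suc n) = c * expMul c a n + expMul c (a ∘ suc) n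

dilate : ℚ → Seq → Seq
dilate c a n = c ^ℚ n * a n

δ₁ : Seq
δ₁ (suc zero) = 1ℚ
δ₁ _          = 0ℚ

expMul-cong : ∀ c {a b} → a ≗ b → expMul c a ≗ expMul c b
expMul-cong c a≗b zero    = a≗b 0
expMul-cong c a≗b (suc n) =
  cong₂ (λ u v → c * u + v) (expMul-cong c a≗b n) (expMul-cong c (a≗b ∘ suc) n)

expMul-⊕ : ∀ c a b → expMul c (a ⊕ b) ≗ expMul c a ⊕ expMul c b
expMul-⊕ c a b zero    = refl
expMul-⊕ c a b (suc n) = begin
  c * expMul c (a ⊕ b) n + expMul c (a ∘ suc ⊕ b ∘ suc) n
    ≡⟨ cong₂ (λ u v → c * u + v) (expMul-⊕ c a b n) (expMul-⊕ c (a ∘ suc) (b ∘ suc) n) ⟩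
  c * (p + q) + (p′ + q′)
    ≡⟨ solve 5 (λ c p q p′ q′ → c :* (p :+ q) :+ (p′ :+ q′) := c :* p :+ p′ :+ (c :* q :+ q′))
               refl c p q p′ q′ ⟩
  c * p + p′ + (c * q + q′) ∎
  where
  p q p′ q′ : ℚ
  p  = expMul c a n
  q  = expMul c b n
  p′ = expMul c (a ∘ suc) n
  q′ = expMul c (b ∘ suc) n

expMul-⊖ : ∀ c a b → expMul c (a ⊖ b) ≗ expMul c a ⊖ expMul c b
expMul-⊖ c a b zero    = refl
expMul-⊖ c a b (suc n) = begin
  c * expMul c (a ⊖ b) n + expMul c (a ∘ suc ⊖ b ∘ suc) n
    ≡⟨ cong₂ (λ u v → c * u + v) (expMul-⊖ c a b n) (expMul-⊖ c (a ∘ suc) (b ∘ suc) n) ⟩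
  c * (p - q) + (p′ - q′)
    ≡⟨ solve 5 (λ c p q p′ q′ → c :* (p :- q) :+ (p′ :- q′) := c :* p :+ p′ :- (c :* q :+ q′))
               refl c p q p′ q′ ⟩
  c * p + p′ - (c * q + q′) ∎
  where
  p q p′ q′ : ℚ
  p  = expMul c a n
  q  = expMul c b n
  p′ = expMul c (a ∘ suc) n
  q′ = expMul c (b ∘ suc) n

expMul-⊛ : ∀ c x a → expMul c (x ⊛ a) ≗ x ⊛ expMul c a
expMul-⊛ c x a zero    = refl
expMul-⊛ c x a (suc n) = begin
  c * expMul c (x ⊛ a) n + expMul c (x ⊛ a ∘ suc) n
    ≡⟨ cong₂ (λ u v → c * u + v) (expMul-⊛ c x a n) (expMul-⊛ c x (a ∘ suc) n) ⟩
  c * (x * p) + x * p′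
    ≡⟨ solve 4 (λ c x p p′ → c :* (x :* p) :+ x :* p′ := x :* (c :* p :+ p′)) refl c x p p′ ⟩
  x * (c * p + p′) ∎
  where
  p p′ : ℚ
  p  = expMul c a n
  p′ = expMul c (a ∘ suc) n

expMul-expMul : ∀ c d a → expMul c (expMul d a) ≗ expMul (c + d) a
expMul-expMul c d a zero    = refl
expMul-expMul c d a (suc n) = begin
  c * u + expMul c (d ⊛ expMul d a ⊕ expMul d (a ∘ suc)) n
    ≡⟨ cong (c * u +_) (expMul-⊕ c (d ⊛ expMul d a) (expMul d (a ∘ suc)) n) ⟩
  c * u + (expMul c (d ⊛ expMul d a) n + u′)
    ≡⟨ cong (λ v → c * u + (v + u′)) (expMul-⊛ c d (expMul d a) n) ⟩
  c * u + (d * u + u′)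
    ≡⟨ cong₂ (λ v v′ → c * v + (d * v + v′)) (expMul-expMul c d a n) (expMul-expMul c d (a ∘ suc) n) ⟩
  c * p + (d * p + p′)
    ≡⟨ solve 4 (λ c d p p′ → c :* p :+ (d :* p :+ p′) := (c :+ d) :* p :+ p′) refl c d p p′ ⟩
  (c + d) * p + p′ ∎
  where
  u u′ p p′ : ℚ
  u  = expMul c (expMul d a) n
  u′ = expMul c (expMul d (a ∘ suc)) n
  p  = expMul (c + d) a n
  p′ = expMul (c + d) (a ∘ suc) n

expMul-0 : ∀ a → expMul 0ℚ a ≗ a
expMul-0 a zero    = refl
expMul-0 a (suc n) = begin
  0ℚ * expMul 0ℚ a n + expMul 0ℚ (a ∘ suc) n ≡⟨ cong (_+ expMul 0ℚ (a ∘ suc) n) (ℚ.*-zeroˡ (expMul 0ℚ a n)) ⟩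
  0ℚ + expMul 0ℚ (a ∘ suc) n                 ≡⟨ ℚ.+-identityˡ _ ⟩
  expMul 0ℚ (a ∘ suc) n                      ≡⟨ expMul-0 (a ∘ suc) n ⟩
  a (suc n)                                  ∎

expMul-inverse : ∀ c a → expMul (- c) (expMul c a) ≗ a
expMul-inverse c a n = begin
  expMul (- c) (expMul c a) n ≡⟨ expMul-expMul (- c) c a n ⟩
  expMul (- c + c) a n        ≡⟨ cong (λ r → expMul r a n) (ℚ.+-inverseˡ c) ⟩
  expMul 0ℚ a n               ≡⟨ expMul-0 a n ⟩
  a n                         ∎

dilate-expMul : ∀ d c a → dilate d (expMul c a) ≗ expMul (d * c) (dilate d a)
dilate-expMul d c a zero    = refl
dilate-expMul d c a (suc n) = begin
  d * d ^ℚ n * (c * expMul c a n + expMul c (a ∘ suc) n)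
    ≡⟨ solve 5 (λ d p c u u′ → d :* p :* (c :* u :+ u′) := d :* c :* (p :* u) :+ d :* (p :* u′))
               refl d (d ^ℚ n) c (expMul c a n) (expMul c (a ∘ suc) n) ⟩
  d * c * dilate d (expMul c a) n + d * dilate d (expMul c (a ∘ suc)) n
    ≡⟨ cong₂ (λ v v′ → d * c * v + d * v′) (dilate-expMul d c a n) (dilate-expMul d c (a ∘ suc) n) ⟩
  d * c * v + d * expMul (d * c) (dilate d (a ∘ suc)) n
    ≡⟨ cong (d * c * v +_) (expMul-⊛ (d * c) d (dilate d (a ∘ suc)) n) ⟨
  d * c * v + expMul (d * c) (d ⊛ dilate d (a ∘ suc)) n
    ≡⟨ cong (d * c * v +_) (expMul-cong (d * c) (λ j → sym (ℚ.*-assoc d (d ^ℚ j) (a (suc j)))) n) ⟩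
  d * c * v + expMul (d * c) (dilate d a ∘ suc) n ∎
  where
  v : ℚ
  v = expMul (d * c) (dilate d a) n

dilate-δ₁ : ∀ c → dilate c δ₁ ≗ c ⊛ δ₁
dilate-δ₁ c zero          = trans (ℚ.*-zeroʳ 1ℚ) (sym (ℚ.*-zeroʳ c))
dilate-δ₁ c (suc zero)    = ℚ.*-identityʳ (c * 1ℚ)
dilate-δ₁ c (suc (suc n)) = trans (ℚ.*-zeroʳ (c ^ℚ suc (suc n))) (sym (ℚ.*-zeroʳ c))

expMul-1-binomial : ∀ a n → expMul 1ℚ a n ≡ ∑ (suc n) (λ j → ℕ→ℚ (n C j) * a j)
expMul-1-binomial a zero    = solve 1 (λ x → x := con 1ℚ :* x :+ con 0ℚ) refl (a 0)
expMul-1-binomial a (suc n) = begin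
  1ℚ * expMul 1ℚ a n + expMul 1ℚ (a ∘ suc) n
    ≡⟨ cong₂ (λ u v → 1ℚ * u + v) (expMul-1-binomial a n) (expMul-1-binomial (a ∘ suc) n) ⟩
  1ℚ * (1ℚ * a 0 + ∑ n P) + ∑ (suc n) Q
    ≡⟨ cong (λ s → 1ℚ * (1ℚ * a 0 + s) + ∑ (suc n) Q) last-term-vanishes ⟩
  1ℚ * (1ℚ * a 0 + ∑ (suc n) P) + ∑ (suc n) Q
    ≡⟨ solve 3 (λ x p q → con 1ℚ :* (con 1ℚ :* x :+ p) :+ q := con 1ℚ :* x :+ (q :+ p))
               refl (a 0) (∑ (suc n) P) (∑ (suc n) Q) ⟩
  1ℚ * a 0 + (∑ (suc n) Q + ∑ (suc n) P)
    ≡⟨ cong (1ℚ * a 0 +_) (∑-distrib-+ {suc n} (Q ∘ toℕ) (P ∘ toℕ)) ⟨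
  1ℚ * a 0 + ∑ (suc n) (Q ⊕ P)
    ≡⟨ cong (1ℚ * a 0 +_) (∑-cong (suc n) pascal) ⟩
  1ℚ * a 0 + ∑ (suc n) (λ j → ℕ→ℚ (suc n C suc j) * a (suc j)) ∎
  where
  P Q : Seq
  P j = ℕ→ℚ (n C suc j) * a (suc j)
  Q j = ℕ→ℚ (n C j) * a (suc j)
  last-term-vanishes : ∑ n P ≡ ∑ (suc n) P
  last-term-vanishes = sym (begin
    ∑ (suc n) P                         ≡⟨ ∑-last n P ⟩
    ∑ n P + ℕ→ℚ (n C suc n) * a (suc n) ≡⟨ cong (λ c → ∑ n P + ℕ→ℚ c * a (suc n)) (k>n⇒nCk≡0 (ℕ.n<1+n n)) ⟩
    ∑ n P + 0ℚ * a (suc n)              ≡⟨ solve 2 (λ s x → s :+ con 0ℚ :* x := s) refl (∑ n P) (a (suc n)) ⟩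
    ∑ n P                               ∎)
  pascal : Q ⊕ P ≗ λ j → ℕ→ℚ (suc n C suc j) * a (suc j)
  pascal j = begin
    ℕ→ℚ (n C j) * a (suc j) + ℕ→ℚ (n C suc j) * a (suc j)
      ≡⟨ ℚ.*-distribʳ-+ (a (suc j)) (ℕ→ℚ (n C j)) (ℕ→ℚ (n C suc j)) ⟨
    (ℕ→ℚ (n C j) + ℕ→ℚ (n C suc j)) * a (suc j)
      ≡⟨ cong (_* a (suc j)) (ℕ→ℚ-+ (n C j) (n C suc j)) ⟨
    ℕ→ℚ (n C j ℕ.+ n C suc j) * a (suc j)
      ≡⟨ cong (λ c → ℕ→ℚ c * a (suc j)) (nCk+nC[k+1]≡[n+1]C[k+1] n j) ⟩
    ℕ→ℚ (suc n C suc j) * a (suc j) ∎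

expMul-lowest : ∀ c a {n} → (∀ {j} → j < n → a j ≡ 0ℚ) → expMul c a n ≡ a n
expMul-lowest c a {zero}  _     = refl
expMul-lowest c a {suc n} a<n≡0 = begin
  c * expMul c a n + expMul c (a ∘ suc) n
    ≡⟨ cong₂ (λ u v → c * u + v)
             (trans (expMul-lowest c a (a<n≡0 ∘ ℕ.m<n⇒m<1+n)) (a<n≡0 (ℕ.n<1+n n)))
             (expMul-lowest c (a ∘ suc) (a<n≡0 ∘ ℕ.s≤s)) ⟩
  c * 0ℚ + a (suc n) ≡⟨ cong (_+ a (suc n)) (ℚ.*-zeroʳ c) ⟩
  0ℚ + a (suc n)     ≡⟨ ℚ.+-identityˡ (a (suc n)) ⟩
  a (suc n)          ∎

expMul-next : ∀ c a {n} → (∀ {j} → j < n → a j ≡ 0ℚ) →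
              expMul c a (suc n) ≡ ℕ→ℚ (suc n) * c * a n + a (suc n)
expMul-next c a {zero}  _     = cong (λ u → u * a 0 + a 1) (sym (ℚ.*-identityˡ c))
expMul-next c a {suc n} a<n≡0 = begin
  c * expMul c a (suc n) + expMul c (a ∘ suc) (suc n)
    ≡⟨ cong₂ (λ u v → c * u + v) (expMul-lowest c a a<n≡0) (expMul-next c (a ∘ suc) (a<n≡0 ∘ ℕ.s≤s)) ⟩
  c * a (suc n) + (ℕ→ℚ (suc n) * c * a (suc n) + a (suc (suc n)))
    ≡⟨ solve 4 (λ c x m y → c :* x :+ (m :* c :* x :+ y) := (con 1ℚ :+ m) :* c :* x :+ y)
               refl c (a (suc n)) (ℕ→ℚ (suc n)) (a (suc (suc n))) ⟩
  (1ℚ + ℕ→ℚ (suc n)) * c * a (suc n) + a (suc (suc n))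
    ≡⟨ cong (λ u → u * c * a (suc n) + a (suc (suc n))) (ℕ→ℚ-+ 1 (suc n)) ⟨
  ℕ→ℚ (suc (suc n)) * c * a (suc n) + a (suc (suc n)) ∎

expMul-fixed⇒≡0 : ∀ c a .{{_ : NonZero c}} → expMul c a ≗ a → ∀ n → a n ≡ 0ℚ
expMul-fixed⇒≡0 c a fixed = <-rec (λ n → a n ≡ 0ℚ) step
  where
  step : ∀ n → (∀ {j} → j < n → a j ≡ 0ℚ) → a n ≡ 0ℚ
  step n a<n≡0 = x*y≡0⇒y≡0 c (x*y≡0⇒y≡0 (ℕ→ℚ (suc n)) {{ℕ→ℚ-nonZero n}} (begin
    ℕ→ℚ (suc n) * (c * a n)
      ≡⟨ solve 4 (λ m c x y → m :* (c :* x) := m :* c :* x :+ y :- y) refl (ℕ→ℚ (suc n)) c (a n) (a (suc n)) ⟩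
    ℕ→ℚ (suc n) * c * a n + a (suc n) - a (suc n)
      ≡⟨ cong (_- a (suc n)) (expMul-next c a a<n≡0) ⟨
    expMul c a (suc n) - a (suc n) ≡⟨ cong (_- a (suc n)) (fixed (suc n)) ⟩
    a (suc n) - a (suc n)          ≡⟨ ℚ.+-inverseʳ (a (suc n)) ⟩
    0ℚ                             ∎))

expMul+expMul≡0⇒≡0 : ∀ c d a → (∀ n → expMul c a n + expMul d a n ≡ 0ℚ) → ∀ n → a n ≡ 0ℚ
expMul+expMul≡0⇒≡0 c d a sum≡0 = <-rec (λ n → a n ≡ 0ℚ) step
  where
  step : ∀ n → (∀ {j} → j < n → a j ≡ 0ℚ) → a n ≡ 0ℚ
  step n a<n≡0 = x*y≡0⇒y≡0 2ℚ (begin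
    2ℚ * a n                    ≡⟨ solve 1 (λ x → con 2ℚ :* x := x :+ x) refl (a n) ⟩
    a n + a n                   ≡⟨ cong₂ _+_ (expMul-lowest c a a<n≡0) (expMul-lowest d a a<n≡0) ⟨
    expMul c a n + expMul d a n ≡⟨ sum≡0 n ⟩
    0ℚ                          ∎)

lookup-∷ʳ : ∀ {n} (f : Seq) (xs : Vec ℚ n) → (∀ j → lookup xs j ≡ f (toℕ j)) →
            ∀ j → lookup (xs ∷ʳ f n) j ≡ f (toℕ j)
lookup-∷ʳ f []       _    Fin.zero    = refl
lookup-∷ʳ f (x ∷ xs) xs≡f Fin.zero    = xs≡f Fin.zero
lookup-∷ʳ f (x ∷ xs) xs≡f (Fin.suc j) = lookup-∷ʳ (f ∘ suc) xs (xs≡f ∘ Fin.suc) j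

lookup-bernoulliTable : ∀ n j → lookup (bernoulliTable n) j ≡ B (toℕ j)
lookup-bernoulliTable (suc n) = lookup-∷ʳ B (bernoulliTable n) (lookup-bernoulliTable n)

B-suc : ∀ m → B (suc m) ≡ - (frac 1 (suc (suc m)) * ∑ (suc m) (λ j → ℕ→ℚ (suc (suc m) C j) * B j))
B-suc m = cong (λ s → - (frac 1 (suc (suc m)) * s)) (trans
  (sumℚ-allFin (suc m) (λ j → ℕ→ℚ (suc (suc m) C toℕ j) * lookup (bernoulliTable (suc m)) j))
  (sum-cong-≗ {suc m} (λ j → cong (ℕ→ℚ (suc (suc m) C toℕ j) *_) (lookup-bernoulliTable (suc m) j))))

∑-binomial-B : ∀ n → ∑ n (λ j → ℕ→ℚ (n C j) * B j) ≡ δ₁ n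
∑-binomial-B zero          = refl
∑-binomial-B (suc zero)    = refl
∑-binomial-B (suc (suc m)) = begin
  ∑ (suc (suc m)) f
    ≡⟨ ∑-last (suc m) f ⟩
  S + ℕ→ℚ (suc (suc m) C suc m) * B (suc m)
    ≡⟨ cong₂ (λ c b → S + ℕ→ℚ c * b) ([1+n]Cn≡1+n (suc m)) (B-suc m) ⟩
  S + N * - (F * S)
    ≡⟨ solve 3 (λ s n f → s :+ n :* (:- (f :* s)) := s :- f :* n :* s) refl S N F ⟩
  S - F * N * S
    ≡⟨ cong (λ u → S - u * S) (frac-*-ℕ→ℚ 1 (suc (suc m))) ⟩
  S - 1ℚ * S
    ≡⟨ solve 1 (λ s → s :- con 1ℚ :* s := con 0ℚ) refl S ⟩
  0ℚ ∎
  where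
  f : Seq
  f j = ℕ→ℚ (suc (suc m) C j) * B j
  S N F : ℚ
  S = ∑ (suc m) f
  N = ℕ→ℚ (suc (suc m))
  F = frac 1 (suc (suc m))

expMul-B : expMul 1ℚ B ≗ B ⊕ δ₁
expMul-B n = begin
  expMul 1ℚ B n
    ≡⟨ expMul-1-binomial B n ⟩
  ∑ (suc n) (λ j → ℕ→ℚ (n C j) * B j)
    ≡⟨ ∑-last n (λ j → ℕ→ℚ (n C j) * B j) ⟩
  ∑ n (λ j → ℕ→ℚ (n C j) * B j) + ℕ→ℚ (n C n) * B n
    ≡⟨ cong₂ (λ s c → s + ℕ→ℚ c * B n) (∑-binomial-B n) (nCn≡1 n) ⟩
  δ₁ n + 1ℚ * B n
    ≡⟨ solve 2 (λ d b → d :+ con 1ℚ :* b := b :+ d) refl (δ₁ n) (B n) ⟩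
  B n + δ₁ n ∎

expMul-dilate-B : ∀ c → expMul c (dilate c B) ≗ dilate c B ⊕ c ⊛ δ₁
expMul-dilate-B c n = begin
  expMul c (dilate c B) n        ≡⟨ cong (λ r → expMul r (dilate c B) n) (ℚ.*-identityʳ c) ⟨
  expMul (c * 1ℚ) (dilate c B) n ≡⟨ dilate-expMul c 1ℚ B n ⟨
  c ^ℚ n * expMul 1ℚ B n         ≡⟨ cong (c ^ℚ n *_) (expMul-B n) ⟩
  c ^ℚ n * (B n + δ₁ n)          ≡⟨ ℚ.*-distribˡ-+ (c ^ℚ n) (B n) (δ₁ n) ⟩
  dilate c B n + dilate c δ₁ n   ≡⟨ cong (dilate c B n +_) (dilate-δ₁ c n) ⟩
  dilate c B n + c * δ₁ n        ∎

-- H(z) = B(4z) − B(2z) = 4z/(e^{4z} − 1) − 2z/(e^{2z} − 1) = −2z/(e^{2z} + 1) = z tanh z − z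
zTanh-z : Seq
zTanh-z = dilate 4ℚ B ⊖ dilate 2ℚ B

expMul-4-zTanh-z : expMul 4ℚ zTanh-z ≗ zTanh-z ⊕ 2ℚ ⊛ δ₁ ⊖ 2ℚ ⊛ expMul 2ℚ δ₁
expMul-4-zTanh-z n = begin
  expMul 4ℚ zTanh-z n
    ≡⟨ expMul-⊖ 4ℚ (dilate 4ℚ B) (dilate 2ℚ B) n ⟩
  expMul 4ℚ (dilate 4ℚ B) n - expMul 4ℚ (dilate 2ℚ B) n
    ≡⟨ cong₂ _-_ (expMul-dilate-B 4ℚ n) (sym (expMul-expMul 2ℚ 2ℚ (dilate 2ℚ B) n)) ⟩
  b₄ + 4ℚ * δ₁ n - expMul 2ℚ (expMul 2ℚ (dilate 2ℚ B)) n
    ≡⟨ cong (λ u → b₄ + 4ℚ * δ₁ n - u) (expMul-cong 2ℚ (expMul-dilate-B 2ℚ) n) ⟩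
  b₄ + 4ℚ * δ₁ n - expMul 2ℚ (dilate 2ℚ B ⊕ 2ℚ ⊛ δ₁) n
    ≡⟨ cong (λ u → b₄ + 4ℚ * δ₁ n - u) (expMul-⊕ 2ℚ (dilate 2ℚ B) (2ℚ ⊛ δ₁) n) ⟩
  b₄ + 4ℚ * δ₁ n - (expMul 2ℚ (dilate 2ℚ B) n + expMul 2ℚ (2ℚ ⊛ δ₁) n)
    ≡⟨ cong₂ (λ u v → b₄ + 4ℚ * δ₁ n - (u + v)) (expMul-dilate-B 2ℚ n) (expMul-⊛ 2ℚ 2ℚ δ₁ n) ⟩
  b₄ + 4ℚ * δ₁ n - (b₂ + 2ℚ * δ₁ n + 2ℚ * expMul 2ℚ δ₁ n)
    ≡⟨ solve 4 (λ b₄ b₂ d e → b₄ :+ con 4ℚ :* d :- (b₂ :+ con 2ℚ :* d :+ con 2ℚ :* e)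
                            := b₄ :- b₂ :+ con 2ℚ :* d :- con 2ℚ :* e) refl b₄ b₂ (δ₁ n) (expMul 2ℚ δ₁ n) ⟩
  b₄ - b₂ + 2ℚ * δ₁ n - 2ℚ * expMul 2ℚ δ₁ n ∎
  where
  b₄ b₂ : ℚ
  b₄ = dilate 4ℚ B n
  b₂ = dilate 2ℚ B n

-- X = (e^{2z} + 1) H + 2z is fixed by e^{2z} because (e^{4z} − 1) H = 4z − (e^{2z} + 1) 2z.
expMul-2-zTanh-z : ∀ n → expMul 2ℚ zTanh-z n + zTanh-z n ≡ - (2ℚ * δ₁ n)
expMul-2-zTanh-z n = begin
  expMul 2ℚ zTanh-z n + zTanh-z n
    ≡⟨ solve 2 (λ x y → x := x :+ y :- y) refl (expMul 2ℚ zTanh-z n + zTanh-z n) (2ℚ * δ₁ n) ⟩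
  X n - 2ℚ * δ₁ n
    ≡⟨ cong (_- 2ℚ * δ₁ n) (expMul-fixed⇒≡0 2ℚ X X-fixed n) ⟩
  0ℚ - 2ℚ * δ₁ n
    ≡⟨ ℚ.+-identityˡ (- (2ℚ * δ₁ n)) ⟩
  - (2ℚ * δ₁ n) ∎
  where
  X : Seq
  X = expMul 2ℚ zTanh-z ⊕ zTanh-z ⊕ 2ℚ ⊛ δ₁
  X-fixed : expMul 2ℚ X ≗ X
  X-fixed m = begin
    expMul 2ℚ X m
      ≡⟨ expMul-⊕ 2ℚ (expMul 2ℚ zTanh-z ⊕ zTanh-z) (2ℚ ⊛ δ₁) m ⟩
    expMul 2ℚ (expMul 2ℚ zTanh-z ⊕ zTanh-z) m + expMul 2ℚ (2ℚ ⊛ δ₁) m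
      ≡⟨ cong₂ _+_ (expMul-⊕ 2ℚ (expMul 2ℚ zTanh-z) zTanh-z m) (expMul-⊛ 2ℚ 2ℚ δ₁ m) ⟩
    expMul 2ℚ (expMul 2ℚ zTanh-z) m + expMul 2ℚ zTanh-z m + 2ℚ * expMul 2ℚ δ₁ m
      ≡⟨ cong (λ u → u + expMul 2ℚ zTanh-z m + 2ℚ * expMul 2ℚ δ₁ m)
              (trans (expMul-expMul 2ℚ 2ℚ zTanh-z m) (expMul-4-zTanh-z m)) ⟩
    zTanh-z m + 2ℚ * δ₁ m - 2ℚ * expMul 2ℚ δ₁ m + expMul 2ℚ zTanh-z m + 2ℚ * expMul 2ℚ δ₁ m
      ≡⟨ solve 4 (λ h d e t → h :+ con 2ℚ :* d :- con 2ℚ :* e :+ t :+ con 2ℚ :* e := t :+ h :+ con 2ℚ :* d)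
                 refl (zTanh-z m) (δ₁ m) (expMul 2ℚ δ₁ m) (expMul 2ℚ zTanh-z m) ⟩
    X m ∎

-- With G = e^z H, the series G(z) + G(−z) is killed by e^z + e^{−z}, since
-- (e^{2z} + 1) H(z) = −2z is odd.
expMul-1-zTanh-z-odd : dilate -1ℚ (expMul 1ℚ zTanh-z) ≗ -1ℚ ⊛ expMul 1ℚ zTanh-z
expMul-1-zTanh-z-odd n = begin
  dilate -1ℚ g n
    ≡⟨ solve 2 (λ g r → r := con -1ℚ :* g :+ (g :+ r)) refl (g n) (dilate -1ℚ g n) ⟩
  -1ℚ * g n + (g n + dilate -1ℚ g n)
    ≡⟨ cong (-1ℚ * g n +_) (expMul+expMul≡0⇒≡0 1ℚ -1ℚ w annihilated n) ⟩
  -1ℚ * g n + 0ℚ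
    ≡⟨ ℚ.+-identityʳ (-1ℚ * g n) ⟩
  -1ℚ * g n ∎
  where
  g w : Seq
  g = expMul 1ℚ zTanh-z
  w = g ⊕ dilate -1ℚ g
  annihilated : ∀ m → expMul 1ℚ w m + expMul -1ℚ w m ≡ 0ℚ
  annihilated m = begin
    expMul 1ℚ w m + expMul -1ℚ w m
      ≡⟨ cong₂ _+_ (expMul-⊕ 1ℚ g (dilate -1ℚ g) m) (expMul-⊕ -1ℚ g (dilate -1ℚ g) m) ⟩
    (expMul 1ℚ g m + expMul 1ℚ (dilate -1ℚ g) m) + (expMul -1ℚ g m + expMul -1ℚ (dilate -1ℚ g) m)
      ≡⟨ cong₂ (λ u v → (expMul 1ℚ g m + u) + (expMul -1ℚ g m + v))
               (dilate-expMul -1ℚ -1ℚ g m) (dilate-expMul -1ℚ 1ℚ g m) ⟨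
    (expMul 1ℚ g m + dilate -1ℚ (expMul -1ℚ g) m) + (expMul -1ℚ g m + dilate -1ℚ (expMul 1ℚ g) m)
      ≡⟨ cong₂ (λ u v → (u + -1ℚ ^ℚ m * v) + (v + -1ℚ ^ℚ m * u))
               (expMul-expMul 1ℚ 1ℚ zTanh-z m) (expMul-inverse 1ℚ zTanh-z m) ⟩
    (t + -1ℚ ^ℚ m * h) + (h + -1ℚ ^ℚ m * t)
      ≡⟨ solve 3 (λ t h p → (t :+ p :* h) :+ (h :+ p :* t) := (t :+ h) :+ p :* (t :+ h)) refl t h (-1ℚ ^ℚ m) ⟩
    (t + h) + -1ℚ ^ℚ m * (t + h)
      ≡⟨ cong (λ u → u + -1ℚ ^ℚ m * u) (expMul-2-zTanh-z m) ⟩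
    - (2ℚ * δ₁ m) + -1ℚ ^ℚ m * - (2ℚ * δ₁ m)
      ≡⟨ solve 2 (λ d p → :- (con 2ℚ :* d) :+ p :* (:- (con 2ℚ :* d)) := :- con 2ℚ :* (d :+ p :* d))
                 refl (δ₁ m) (-1ℚ ^ℚ m) ⟩
    - 2ℚ * (δ₁ m + dilate -1ℚ δ₁ m)
      ≡⟨ cong (λ u → - 2ℚ * (δ₁ m + u)) (dilate-δ₁ -1ℚ m) ⟩
    - 2ℚ * (δ₁ m + -1ℚ * δ₁ m)
      ≡⟨ solve 1 (λ d → :- con 2ℚ :* (d :+ con -1ℚ :* d) := con 0ℚ) refl (δ₁ m) ⟩
    0ℚ ∎
    where
    t h : ℚ
    t = expMul 2ℚ zTanh-z m
    h = zTanh-z m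

-- H(−z) = e^z G(−z) = −e^z G(z) = −e^{2z} H(z) = H(z) + 2z
zTanh-z-reflect : ∀ n → -1ℚ ^ℚ n * zTanh-z n ≡ zTanh-z n + 2ℚ * δ₁ n
zTanh-z-reflect n = begin
  -1ℚ ^ℚ n * h
    ≡⟨ cong (-1ℚ ^ℚ n *_) (expMul-inverse 1ℚ zTanh-z n) ⟨
  dilate -1ℚ (expMul -1ℚ g) n
    ≡⟨ dilate-expMul -1ℚ -1ℚ g n ⟩
  expMul 1ℚ (dilate -1ℚ g) n
    ≡⟨ expMul-cong 1ℚ expMul-1-zTanh-z-odd n ⟩
  expMul 1ℚ (-1ℚ ⊛ g) n
    ≡⟨ expMul-⊛ 1ℚ -1ℚ g n ⟩
  -1ℚ * expMul 1ℚ g n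
    ≡⟨ cong (-1ℚ *_) (expMul-expMul 1ℚ 1ℚ zTanh-z n) ⟩
  -1ℚ * t
    ≡⟨ solve 3 (λ t h d → con -1ℚ :* t := h :+ con 2ℚ :* d :- (t :+ h :+ con 2ℚ :* d)) refl t h (δ₁ n) ⟩
  h + 2ℚ * δ₁ n - (t + h + 2ℚ * δ₁ n)
    ≡⟨ cong (λ u → h + 2ℚ * δ₁ n - (u + 2ℚ * δ₁ n)) (expMul-2-zTanh-z n) ⟩
  h + 2ℚ * δ₁ n - (- (2ℚ * δ₁ n) + 2ℚ * δ₁ n)
    ≡⟨ solve 2 (λ h d → h :+ con 2ℚ :* d :- (:- (con 2ℚ :* d) :+ con 2ℚ :* d) := h :+ con 2ℚ :* d)
               refl h (δ₁ n) ⟩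
  h + 2ℚ * δ₁ n ∎
  where
  g : Seq
  g = expMul 1ℚ zTanh-z
  t h : ℚ
  t = expMul 2ℚ zTanh-z n
  h = zTanh-z n

expMul-1-zTanh-z-even : ∀ k → expMul 1ℚ zTanh-z (2 *ℕ k) ≡ 0ℚ
expMul-1-zTanh-z-even k = x*y≡0⇒y≡0 2ℚ (begin
  2ℚ * g                         ≡⟨ solve 1 (λ g → con 2ℚ :* g := con 1ℚ :* g :- con -1ℚ :* g) refl g ⟩
  1ℚ * g - -1ℚ * g               ≡⟨ cong (λ p → p * g - -1ℚ * g) ([-1]^[2m]≡1 k) ⟨
  -1ℚ ^ℚ (2 *ℕ k) * g - -1ℚ * g ≡⟨ cong (_- -1ℚ * g) (expMul-1-zTanh-z-odd (2 *ℕ k)) ⟩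
  -1ℚ * g - -1ℚ * g              ≡⟨ ℚ.+-inverseʳ (-1ℚ * g) ⟩
  0ℚ                             ∎)
  where
  g : ℚ
  g = expMul 1ℚ zTanh-z (2 *ℕ k)

zTanh-z-odd : ∀ m → zTanh-z (suc (2 *ℕ suc m)) ≡ 0ℚ
zTanh-z-odd m = x*y≡0⇒y≡0 2ℚ (begin
  2ℚ * h                     ≡⟨ solve 1 (λ h → con 2ℚ :* h := h :+ con 2ℚ :* con 0ℚ :- con -1ℚ :* h) refl h ⟩
  h + 2ℚ * 0ℚ - -1ℚ * h      ≡⟨ cong (λ p → h + 2ℚ * 0ℚ - -1ℚ * p * h) ([-1]^[2m]≡1 (suc m)) ⟨
  h + 2ℚ * 0ℚ - -1ℚ ^ℚ n * h ≡⟨ cong (_- -1ℚ ^ℚ n * h) (zTanh-z-reflect n) ⟨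
  -1ℚ ^ℚ n * h - -1ℚ ^ℚ n * h ≡⟨ ℚ.+-inverseʳ (-1ℚ ^ℚ n * h) ⟩
  0ℚ                         ∎)
  where
  n : ℕ
  n = suc (2 *ℕ suc m)
  h : ℚ
  h = zTanh-z n

prefactor : ℕ → ℚ
prefactor k = frac k (((2 ^ (2 *ℕ k)) ∸ 1) *ℕ (2 ^ ((2 *ℕ k) ∸ 1)))

summand : ℕ → ℕ → ℚ
summand k ℓ = ℕ→ℚ (((2 *ℕ k) ∸ 1) C ((2 *ℕ ℓ) ∸ 1))
            * ℕ→ℚ (((2 ^ (2 *ℕ ℓ)) ∸ 1) *ℕ (2 ^ (2 *ℕ ℓ)))
            * (B (2 *ℕ ℓ) * frac 1 (2 *ℕ ℓ))

C*zTanh-z≡2k*summand : ∀ k ℓ → ℕ→ℚ (2 *ℕ suc k C 2 *ℕ suc ℓ) * zTanh-z (2 *ℕ suc ℓ)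
                               ≡ ℕ→ℚ (2 *ℕ suc k) * summand (suc k) (suc ℓ)
C*zTanh-z≡2k*summand k ℓ = begin
  ℕ→ℚ (suc M C suc j) * (4ℚ ^ℚ L * b - 2ℚ ^ℚ L * b)
    ≡⟨ cong (_* (4ℚ ^ℚ L * b - 2ℚ ^ℚ L * b)) (ℕ→ℚ-[1+n]C[1+k] M j) ⟩
  N * ℕ→ℚ (M C j) * F * (4ℚ ^ℚ L * b - 2ℚ ^ℚ L * b)
    ≡⟨ solve 6 (λ n c f p q b → n :* c :* f :* (p :* b :- q :* b) := n :* (c :* (p :- q) :* (b :* f)))
               refl N (ℕ→ℚ (M C j)) F (4ℚ ^ℚ L) (2ℚ ^ℚ L) b ⟩
  N * (ℕ→ℚ (M C j) * (4ℚ ^ℚ L - 2ℚ ^ℚ L) * (b * F))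
    ≡⟨ cong (λ p → N * (ℕ→ℚ (M C j) * p * (b * F))) (ℕ→ℚ-[2^L-1]*2^L L) ⟨
  N * summand (suc k) (suc ℓ) ∎
  where
  M j L : ℕ
  M = 2 *ℕ suc k ∸ 1
  j = 2 *ℕ suc ℓ ∸ 1
  L = 2 *ℕ suc ℓ
  N F b : ℚ
  N = ℕ→ℚ (2 *ℕ suc k)
  F = frac 1 L
  b = B L

-- Split Σ_j C(2k, j) h_j into h_0 = 0, the odd terms (where h_1 = −1; h_0 and h_1 are
-- computed by evaluation) and the even terms C(2k, 2ℓ) h_{2ℓ} = 2k · summand k ℓ.
∑-binomial-zTanh-z : ∀ k → let n = 2 *ℕ suc k in
  ∑ (suc n) (λ j → ℕ→ℚ (n C j) * zTanh-z j) ≡ ℕ→ℚ n * (∑ (suc k) (summand (suc k) ∘ suc) - 1ℚ)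
∑-binomial-zTanh-z k = begin
  F 0 + ∑ n (F ∘ suc)                   ≡⟨ cong (F 0 +_) (∑-pairs (suc k) (F ∘ suc)) ⟩
  F 0 + (G 0 + ∑ k (G ∘ suc))           ≡⟨ cong (λ u → F 0 + (G 0 + u)) (∑-cong k G-suc) ⟩
  F 0 + (G 0 + ∑ k (λ l → N * s (suc (suc l))))
    ≡⟨ cong (λ u → F 0 + (G 0 + u)) (*-distribˡ-sum {k} N (s ∘ suc ∘ suc ∘ toℕ)) ⟨
  F 0 + (G 0 + N * T)
    ≡⟨ cong₂ (λ c u → 0ℚ + (ℕ→ℚ c * - 1ℚ + u + N * T)) (nC1≡n n) (C*zTanh-z≡2k*summand k 0) ⟩
  0ℚ + (N * - 1ℚ + N * s 1 + N * T)
    ≡⟨ solve 3 (λ n a t → con 0ℚ :+ (n :* (:- con 1ℚ) :+ n :* a :+ n :* t) := n :* (a :+ t :- con 1ℚ))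
               refl N (s 1) T ⟩
  N * (s 1 + T - 1ℚ)                    ∎
  where
  n : ℕ
  n = 2 *ℕ suc k
  s : ℕ → ℚ
  s = summand (suc k)
  N T : ℚ
  N = ℕ→ℚ n
  T = ∑ k (s ∘ suc ∘ suc)
  F G : Seq
  F j = ℕ→ℚ (n C j) * zTanh-z j
  G l = F (suc (2 *ℕ l)) + F (suc (suc (2 *ℕ l)))
  G-suc : ∀ l → G (suc l) ≡ N * s (suc (suc l))
  G-suc l = begin
    F (suc (2 *ℕ suc l)) + F (suc (suc (2 *ℕ suc l)))
      ≡⟨ cong₂ (λ h m → ℕ→ℚ (n C suc (2 *ℕ suc l)) * h + F m) (zTanh-z-odd l) (sym (ℕ.*-suc 2 (suc l))) ⟩
    ℕ→ℚ (n C suc (2 *ℕ suc l)) * 0ℚ + F (2 *ℕ suc (suc l))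
      ≡⟨ cong₂ _+_ (ℚ.*-zeroʳ (ℕ→ℚ (n C suc (2 *ℕ suc l)))) (C*zTanh-z≡2k*summand k (suc l)) ⟩
    0ℚ + N * s (suc (suc l))
      ≡⟨ ℚ.+-identityˡ (N * s (suc (suc l))) ⟩
    N * s (suc (suc l)) ∎

∑-summand≡1 : ∀ k → ∑ (suc k) (summand (suc k) ∘ suc) ≡ 1ℚ
∑-summand≡1 k = begin
  S             ≡⟨ solve 1 (λ s → s := s :- con 1ℚ :+ con 1ℚ) refl S ⟩
  (S - 1ℚ) + 1ℚ ≡⟨ cong (_+ 1ℚ) (x*y≡0⇒y≡0 (ℕ→ℚ n) {{ℕ→ℚ-nonZero (n ∸ 1)}} 2k*[S-1]≡0) ⟩
  0ℚ + 1ℚ       ≡⟨⟩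
  1ℚ            ∎
  where
  n : ℕ
  n = 2 *ℕ suc k
  S : ℚ
  S = ∑ (suc k) (summand (suc k) ∘ suc)
  2k*[S-1]≡0 : ℕ→ℚ n * (S - 1ℚ) ≡ 0ℚ
  2k*[S-1]≡0 = begin
    ℕ→ℚ n * (S - 1ℚ)                          ≡⟨ ∑-binomial-zTanh-z k ⟨
    ∑ (suc n) (λ j → ℕ→ℚ (n C j) * zTanh-z j) ≡⟨ expMul-1-binomial zTanh-z n ⟨
    expMul 1ℚ zTanh-z n                       ≡⟨ expMul-1-zTanh-z-even (suc k) ⟩
    0ℚ                                        ∎

summand-last : ∀ k → summand (suc k) (suc k) ≡ 1ℚ - Σ< k (summand (suc k) ∘ suc)
summand-last k = begin
  x                 ≡⟨ solve 2 (λ x s → x := s :+ x :- s) refl x (∑ k f) ⟩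
  ∑ k f + x - ∑ k f ≡⟨ cong (_- ∑ k f) (trans (sym (∑-last k f)) (∑-summand≡1 k)) ⟩
  1ℚ - ∑ k f        ≡⟨ cong (λ s → 1ℚ - s) (Σ<≡∑ k f) ⟨
  1ℚ - Σ< k f       ∎
  where
  f : Seq
  f = summand (suc k) ∘ suc
  x : ℚ
  x = summand (suc k) (suc k)

B≡prefactor*summand : ∀ k → B (2 *ℕ suc k) ≡ prefactor (suc k) * summand (suc k) (suc k)
B≡prefactor*summand k = begin
  B L                                ≡⟨ ℚ.*-identityˡ (B L) ⟨
  1ℚ * B L                           ≡⟨ cong (_* B L) (frac-*-ℕ→ℚ 1 L) ⟨
  F * ℕ→ℚ L * B L                    ≡⟨ cong (λ l → F * l * B L) (ℕ→ℚ-* 2 (suc k)) ⟩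
  F * (2ℚ * ℕ→ℚ (suc k)) * B L       ≡⟨ cong (λ x → F * (2ℚ * x) * B L) (frac-*-ℕ→ℚ (suc k) D {{D≢0}}) ⟨
  F * (2ℚ * (P * ℕ→ℚ D)) * B L
    ≡⟨ solve 4 (λ f p d b → f :* (con 2ℚ :* (p :* d)) :* b := p :* (con 1ℚ :* (d :* con 2ℚ) :* (b :* f)))
               refl F P (ℕ→ℚ D) (B L) ⟩
  P * (1ℚ * (ℕ→ℚ D * 2ℚ) * (B L * F))
    ≡⟨ cong₂ (λ c d → P * (ℕ→ℚ c * d * (B L * F))) (sym (nCn≡1 (L ∸ 1)))
             (trans (sym (ℕ→ℚ-* D 2)) (cong ℕ→ℚ D*2≡D′)) ⟩
  P * summand (suc k) (suc k)        ∎
  where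
  L p D : ℕ
  L = 2 *ℕ suc k
  p = 2 ^ (L ∸ 1)
  D = (2 ^ L ∸ 1) *ℕ p
  P F : ℚ
  P = prefactor (suc k)
  F = frac 1 L
  D≢0 : ℕ.NonZero D
  D≢0 = ℕ.m*n≢0 (2 ^ L ∸ 1) p {{ℕ.>-nonZero (ℕ.m<n⇒0<n∸m (ℕ.*-monoʳ-≤ 2 (ℕ.m^n>0 2 (L ∸ 1))))}}
                              {{ℕ.m^n≢0 2 (L ∸ 1)}}
  -- 2 ^ L unfolds to 2 *ℕ p because L is a successor.
  D*2≡D′ : D *ℕ 2 ≡ (2 ^ L ∸ 1) *ℕ 2 ^ L
  D*2≡D′ = trans (ℕ.*-assoc (2 ^ L ∸ 1) p 2) (cong ((2 ^ L ∸ 1) *ℕ_) (ℕ.*-comm p 2))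

mainTheorem11 : (k : ℕ) → 1 ≤ k →
    B (2 *ℕ k) ≡
      frac k (((2 ^ (2 *ℕ k)) ∸ 1) *ℕ (2 ^ ((2 *ℕ k) ∸ 1)))
      * (1ℚ - Σ< (k ∸ 1) (λ i →
               let ℓ = suc i in
               ℕ→ℚ (((2 *ℕ k) ∸ 1) C ((2 *ℕ ℓ) ∸ 1))
               * ℕ→ℚ (((2 ^ (2 *ℕ ℓ)) ∸ 1) *ℕ (2 ^ (2 *ℕ ℓ)))
               * (B (2 *ℕ ℓ) * frac 1 (2 *ℕ ℓ))))
mainTheorem11 (suc k) _ = begin
  B (2 *ℕ suc k)                                         ≡⟨ B≡prefactor*summand k ⟩
  prefactor (suc k) * summand (suc k) (suc k)            ≡⟨ cong (prefactor (suc k) *_) (summand-last k) ⟩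
  prefactor (suc k) * (1ℚ - Σ< k (summand (suc k) ∘ suc)) ∎
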